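{- Let $G=(V,E)$ be a simple graph and let $e=uv\in E$ be an edge such that $v$ is a pendant vertex (i.e. $\deg(v)=1$). Then $$\gamma_{\rm st}(G)-1\leq \gamma_{\rm st}(G/e)\leq \gamma_{\rm st}(G)+\deg(u)-1.$$
   Context: For a simple graph $H$, a set $D\subseteq V(H)$ is a strong dominating set of $H$ if for every vertex $x\in V(H)\setminus D$ there is a vertex $y\in D$ with $xy\in E(H)$ and $\deg_H(x)\leq \deg_H(y)$. The strong domination number $\gamma_{\rm st}(H)$ is the minimum cardinality of a strong dominating set of $H$. $G/e$ denotes the graph obtained from $G$ by contracting the edge $e$: the edge $e$ is removed and its two endpoints are merged into a single vertex adjacent to all vertices that were adjacent to either endpoint (no loops or multiple edges). $\deg(u)$ is the degree of $u$ in $G$. -}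

module Defs where

open import Data.Nat using (ℕ; zero; suc; _+_; _≤_)
open import Data.Bool using (Bool; true; false; if_then_else_; _∧_; _∨_; not)
open import Data.Fin using (Fin; punchIn; _≟_)
open import Data.Fin.Subset using (Subset; _∈_; _∉_; ∣_∣)
open import Data.List using (List; map; allFin)
open import Data.Nat.ListAction using (sum)
open import Data.Product using (Σ; ∃; _×_; _,_)
open import Relation.Nullary using (¬_; does)
open import Relation.Binary.PropositionalEquality using (_≡_)

Graph : ℕ → Set
Graph n = Fin n → Fin n → Bool

IsSimple : ∀ {n} → Graph n → Set
IsSimple {n} G = (∀ x y → G x y ≡ G y x) × (∀ x → G x x ≡ false)

Adj : ∀ {n} → Graph n → Fin n → Fin n → Set
Adj G x y = G x y ≡ true

deg : ∀ {n} → Graph n → Fin n → ℕ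
deg {n} G x = sum (map (λ y → if G x y then 1 else 0) (allFin n))

IsStrongDom : ∀ {n} → Graph n → Subset n → Set
IsStrongDom G D = ∀ x → x ∉ D → ∃ λ y → y ∈ D × Adj G x y × deg G x ≤ deg G y

IsGammaSt : ∀ {n} → Graph n → ℕ → Set
IsGammaSt G k = (∃ λ D → IsStrongDom G D × ∣ D ∣ ≡ k)
              × (∀ D → IsStrongDom G D → k ≤ ∣ D ∣)

-- Contraction of the edge uv in a graph on Fin (suc n): the vertex v is deleted
-- (remaining vertices are Fin n, embedded via punchIn v) and u plays the role of
-- the merged vertex, adjacent to every vertex adjacent to u or v; no loops.
eqb : ∀ {m} → Fin m → Fin m → Bool
eqb a b = does (a ≟ b)

contract : ∀ {n} → Graph (suc n) → Fin (suc n) → Fin (suc n) → Graph n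
contract G u v x y =
  let x' = punchIn v x ; y' = punchIn v y in
  not (eqb x' y') ∧
    (G x' y' ∨ (eqb x' u ∧ G v y') ∨ (eqb y' u ∧ G x' v))

{-# OPTIONS --safe #-}
-- Since v is pendant, contracting uv just deletes v, and it leaves the degree of every vertex other
-- than u unchanged. Lower bound: a strong dominating set of G − v together with u strongly dominates
-- G, because u dominates v (deg v = 1 ≤ deg u). Upper bound: for a strong dominating set D of G,
-- (D ∪ N[u]) − v strongly dominates G − v, since a vertex it misses is not adjacent to u, hence
-- neither is its dominator, and neither degree changes. As D contains v or u it meets N[u], so the
-- set has at most ∣D∣ + ∣N[u]∣ − 2 = ∣D∣ + deg u − 1 elements.
module Submission where

open import Defs
open import Data.Nat using (ℕ; zero; suc; _+_; _≤_; _<_; z≤n; s≤s)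
open import Data.Nat.Properties using (module ≤-Reasoning; ≤-trans; ≤-reflexive; m≤m+n; ≤-<-trans; +-monoʳ-≤; +-suc; +-comm; ≤-pred; m<m+n; <-irrefl)
open import Data.Bool using (Bool; true; false; if_then_else_; _∧_; _∨_; not)
open import Data.Bool.Properties using (¬-not; ∨-identityʳ)
open import Data.Fin using (Fin; punchIn; punchOut; _≟_)
open import Data.Fin.Properties using (punchInᵢ≢i; punchIn-punchOut; punchOut-punchIn)
open import Data.Fin.Subset using (Subset; _∈_; _∉_; ∣_∣; inside; outside; ⁅_⁆; _∪_; _∩_)
open import Data.Fin.Subset.Properties using (_∈?_; x∈⁅x⁆; x∈p∪q⁺; x∈p∩q⁺; x∈p∧x≢y⇒x∈p-y; x∈p⇒∣p-x∣<∣p∣; ∣p∣≤∣x∷p∣; p⊆p∪q; q⊆p∪q; ∣⁅x⁆∣≡1)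
open import Data.Vec using (Vec; []; _∷_; lookup; tabulate; insertAt; removeAt)
open import Data.Vec.Properties using (lookup∘tabulate; tabulate∘lookup; tabulate-cong; insertAt-punchIn; insertAt-removeAt; removeAt-punchOut; []=⇒lookup; lookup⇒[]=)
import Data.List as List
open import Data.List.Properties using (map-tabulate)
open import Data.Nat.ListAction using (sum)
open import Data.Product using (∃; _×_; _,_; proj₁; proj₂)
open import Data.Sum using (inj₁; inj₂)
open import Function using (_∘_)
open import Relation.Nullary using (yes; no; contradiction)
open import Relation.Binary.PropositionalEquality using (_≡_; _≢_; refl; sym; trans; cong; cong₂; subst; subst₂; module ≡-Reasoning)

private variable
  n : ℕ

∣insertAt∣ : ∀ (p : Subset n) i b → ∣ insertAt p i b ∣ ≡ ∣ b ∷ p ∣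
∣insertAt∣ p       Fin.zero    b       = refl
∣insertAt∣ (outside ∷ p) (Fin.suc i) b = ∣insertAt∣ p i b
∣insertAt∣ (inside ∷ p)  (Fin.suc i) outside = cong suc (∣insertAt∣ p i outside)
∣insertAt∣ (inside ∷ p)  (Fin.suc i) inside  = cong suc (∣insertAt∣ p i inside)

∣removeAt∣ : ∀ (p : Subset (suc n)) i → ∣ p ∣ ≡ ∣ lookup p i ∷ removeAt p i ∣
∣removeAt∣ p i = begin
  ∣ p ∣                                         ≡⟨ cong ∣_∣ (insertAt-removeAt p i) ⟨
  ∣ insertAt (removeAt p i) i (lookup p i) ∣    ≡⟨ ∣insertAt∣ (removeAt p i) i (lookup p i) ⟩
  ∣ lookup p i ∷ removeAt p i ∣                 ∎
  where open ≡-Reasoning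

lookup-removeAt : ∀ {A : Set} (xs : Vec A (suc n)) i j → lookup (removeAt xs i) j ≡ lookup xs (punchIn i j)
lookup-removeAt xs i j =
  trans (cong (lookup (removeAt xs i)) (sym (punchOut-punchIn i)))
        (removeAt-punchOut xs (punchInᵢ≢i i j ∘ sym))

∈-removeAt⁺ : ∀ (p : Subset (suc n)) i {x} → punchIn i x ∈ p → x ∈ removeAt p i
∈-removeAt⁺ p i {x} x∈p = lookup⇒[]= x _ (trans (lookup-removeAt p i x) ([]=⇒lookup x∈p))

∈-insertAt⁺ : ∀ {p : Subset n} i b {x} → x ∈ p → punchIn i x ∈ insertAt p i b
∈-insertAt⁺ {p = p} i b {x} x∈p = lookup⇒[]= _ _ (trans (insertAt-punchIn p i b x) ([]=⇒lookup x∈p))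

∣p∪q∣+∣p∩q∣≡∣p∣+∣q∣ : ∀ (p q : Subset n) → ∣ p ∪ q ∣ + ∣ p ∩ q ∣ ≡ ∣ p ∣ + ∣ q ∣
∣p∪q∣+∣p∩q∣≡∣p∣+∣q∣ []            []            = refl
∣p∪q∣+∣p∩q∣≡∣p∣+∣q∣ (outside ∷ p) (outside ∷ q) = ∣p∪q∣+∣p∩q∣≡∣p∣+∣q∣ p q
∣p∪q∣+∣p∩q∣≡∣p∣+∣q∣ (inside ∷ p)  (outside ∷ q) = cong suc (∣p∪q∣+∣p∩q∣≡∣p∣+∣q∣ p q)
∣p∪q∣+∣p∩q∣≡∣p∣+∣q∣ (outside ∷ p) (inside ∷ q)  =
  trans (cong suc (∣p∪q∣+∣p∩q∣≡∣p∣+∣q∣ p q)) (sym (+-suc ∣ p ∣ ∣ q ∣))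
∣p∪q∣+∣p∩q∣≡∣p∣+∣q∣ (inside ∷ p)  (inside ∷ q)  =
  cong suc (trans (+-suc ∣ p ∪ q ∣ ∣ p ∩ q ∣)
                  (trans (cong suc (∣p∪q∣+∣p∩q∣≡∣p∣+∣q∣ p q)) (sym (+-suc ∣ p ∣ ∣ q ∣))))

∣p∪q∣≤∣p∣+∣q∣ : ∀ (p q : Subset n) → ∣ p ∪ q ∣ ≤ ∣ p ∣ + ∣ q ∣
∣p∪q∣≤∣p∣+∣q∣ p q = subst (∣ p ∪ q ∣ ≤_) (∣p∪q∣+∣p∩q∣≡∣p∣+∣q∣ p q) (m≤m+n _ _)

x∈p⇒0<∣p∣ : ∀ {p : Subset n} {x} → x ∈ p → 0 < ∣ p ∣
x∈p⇒0<∣p∣ x∈p = ≤-<-trans z≤n (x∈p⇒∣p-x∣<∣p∣ x∈p)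

x∈p∩q⇒∣p∪q∣<∣p∣+∣q∣ : ∀ (p q : Subset n) {x} → x ∈ p ∩ q → ∣ p ∪ q ∣ < ∣ p ∣ + ∣ q ∣
x∈p∩q⇒∣p∪q∣<∣p∣+∣q∣ p q x∈p∩q =
  subst (∣ p ∪ q ∣ <_) (∣p∪q∣+∣p∩q∣≡∣p∣+∣q∣ p q) (m<m+n ∣ p ∪ q ∣ (x∈p⇒0<∣p∣ x∈p∩q))

x∈p∧y∈p∧x≢y⇒1<∣p∣ : ∀ {p : Subset n} {x y} → x ∈ p → y ∈ p → x ≢ y → 1 < ∣ p ∣
x∈p∧y∈p∧x≢y⇒1<∣p∣ x∈p y∈p x≢y =
  ≤-<-trans (x∈p⇒0<∣p∣ (x∈p∧x≢y⇒x∈p-y y∈p (x≢y ∘ sym))) (x∈p⇒∣p-x∣<∣p∣ x∈p)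

nbhd : Graph n → Fin n → Subset n
nbhd G x = tabulate (G x)

deleteVertex : Graph (suc n) → Fin (suc n) → Graph n
deleteVertex G v x y = G (punchIn v x) (punchIn v y)

∣tabulate∣≡sum : ∀ (f : Fin n → Bool) → ∣ tabulate f ∣ ≡ sum (List.tabulate (λ i → if f i then 1 else 0))
∣tabulate∣≡sum {zero}  f = refl
∣tabulate∣≡sum {suc n} f with f Fin.zero
... | true  = cong suc (∣tabulate∣≡sum (f ∘ Fin.suc))
... | false = ∣tabulate∣≡sum (f ∘ Fin.suc)

deg≡∣nbhd∣ : ∀ (G : Graph n) x → deg G x ≡ ∣ nbhd G x ∣
deg≡∣nbhd∣ G x =
  trans (cong sum (map-tabulate (λ y → y) (λ y → if G x y then 1 else 0))) (sym (∣tabulate∣≡sum (G x)))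

Adj⇒∈nbhd : ∀ (G : Graph n) {x y} → Adj G x y → y ∈ nbhd G x
Adj⇒∈nbhd G {x} {y} xy = lookup⇒[]= y _ (trans (lookup∘tabulate (G x) y) xy)

Adj⇒0<deg : ∀ (G : Graph n) {x y} → Adj G x y → 0 < deg G x
Adj⇒0<deg G {x} xy = subst (0 <_) (sym (deg≡∣nbhd∣ G x)) (x∈p⇒0<∣p∣ (Adj⇒∈nbhd G xy))

deg≡1⇒Adj-unique : ∀ (G : Graph n) {x y z} → deg G x ≡ 1 → Adj G x y → Adj G x z → z ≡ y
deg≡1⇒Adj-unique G {x} {y} {z} dx xy xz with z ≟ y
... | yes z≡y = z≡y
... | no z≢y  = contradiction 1<deg (<-irrefl (sym dx))
  where
  1<deg : 1 < deg G x
  1<deg = subst (1 <_) (sym (deg≡∣nbhd∣ G x))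
                (x∈p∧y∈p∧x≢y⇒1<∣p∣ (Adj⇒∈nbhd G xy) (Adj⇒∈nbhd G xz) (z≢y ∘ sym))

deg-resp-≗ : ∀ {G H : Graph n} → (∀ x y → G x y ≡ H x y) → ∀ x → deg G x ≡ deg H x
deg-resp-≗ {G = G} {H} G≗H x =
  trans (deg≡∣nbhd∣ G x) (trans (cong ∣_∣ (tabulate-cong (G≗H x))) (sym (deg≡∣nbhd∣ H x)))

IsStrongDom-resp-≗ : ∀ {G H : Graph n} {D} → (∀ x y → G x y ≡ H x y) → IsStrongDom G D → IsStrongDom H D
IsStrongDom-resp-≗ {G = G} {H} G≗H dom x x∉D with dom x x∉D
... | y , y∈D , xy , dx≤dy =
  y , y∈D , trans (sym (G≗H x y)) xy ,
  subst₂ _≤_ (deg-resp-≗ G≗H x) (deg-resp-≗ G≗H y) dx≤dy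

nbhd-deleteVertex : ∀ (G : Graph (suc n)) v x → nbhd (deleteVertex G v) x ≡ removeAt (nbhd G (punchIn v x)) v
nbhd-deleteVertex G v x = begin
  tabulate (G x′ ∘ punchIn v)         ≡⟨ tabulate-cong (λ j → lookup∘tabulate (G x′) (punchIn v j)) ⟨
  tabulate (lookup p ∘ punchIn v)     ≡⟨ tabulate-cong (lookup-removeAt p v) ⟨
  tabulate (lookup (removeAt p v))    ≡⟨ tabulate∘lookup (removeAt p v) ⟩
  removeAt p v                        ∎
  where open ≡-Reasoning
        x′ = punchIn v x
        p = nbhd G x′

deg-deleteVertex : ∀ (G : Graph (suc n)) v x → deg G (punchIn v x) ≡ ∣ G (punchIn v x) v ∷ nbhd (deleteVertex G v) x ∣
deg-deleteVertex G v x = begin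
  deg G x′                                          ≡⟨ deg≡∣nbhd∣ G x′ ⟩
  ∣ nbhd G x′ ∣                                     ≡⟨ ∣removeAt∣ (nbhd G x′) v ⟩
  ∣ lookup (nbhd G x′) v ∷ removeAt (nbhd G x′) v ∣  ≡⟨ cong₂ (λ b p → ∣ b ∷ p ∣) (lookup∘tabulate (G x′) v)
                                                                              (sym (nbhd-deleteVertex G v x)) ⟩
  ∣ G x′ v ∷ nbhd (deleteVertex G v) x ∣            ∎
  where open ≡-Reasoning
        x′ = punchIn v x

deg-deleteVertex≤ : ∀ (G : Graph (suc n)) v x → deg (deleteVertex G v) x ≤ deg G (punchIn v x)
deg-deleteVertex≤ G v x = subst₂ _≤_ (sym (deg≡∣nbhd∣ (deleteVertex G v) x)) (sym (deg-deleteVertex G v x))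
                                     (∣p∣≤∣x∷p∣ (G (punchIn v x) v) (nbhd (deleteVertex G v) x))

deg-deleteVertex-¬Adj : ∀ (G : Graph (suc n)) v x → G (punchIn v x) v ≡ false →
                        deg (deleteVertex G v) x ≡ deg G (punchIn v x)
deg-deleteVertex-¬Adj G v x x≁v = begin
  deg (deleteVertex G v) x                    ≡⟨ deg≡∣nbhd∣ (deleteVertex G v) x ⟩
  ∣ outside ∷ nbhd (deleteVertex G v) x ∣     ≡⟨ cong (λ b → ∣ b ∷ nbhd (deleteVertex G v) x ∣) x≁v ⟨
  ∣ G (punchIn v x) v ∷ nbhd (deleteVertex G v) x ∣ ≡⟨ deg-deleteVertex G v x ⟨
  deg G (punchIn v x)                         ∎
  where open ≡-Reasoning

module PendantEdge (G : Graph (suc n)) {u v : Fin (suc n)} (simple : IsSimple G)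
                   (u∼v : Adj G u v) (deg-v : deg G v ≡ 1) where

  private
    sym-G = proj₁ simple
    loopless = proj₂ simple

  v∼u : Adj G v u
  v∼u = trans (sym-G v u) u∼v

  v∼y⇒y≡u : ∀ {y} → Adj G v y → y ≡ u
  v∼y⇒y≡u v∼y = deg≡1⇒Adj-unique G deg-v v∼u v∼y

  ≢u⇒≁v : ∀ {x} → x ≢ u → G x v ≡ false
  ≢u⇒≁v {x} x≢u = ¬-not λ x∼v → x≢u (v∼y⇒y≡u (trans (sym-G v x) x∼v))

  private
    -- The only edge at v is uv, so an edge the contraction adds at u would be a loop.
    merged-edge-absent : ∀ a b → a ≢ b → (eqb a u ∧ G v b) ≡ false
    merged-edge-absent a b a≢b with a ≟ u
    ... | no _     = refl
    ... | yes refl = ¬-not λ v∼b → a≢b (sym (v∼y⇒y≡u v∼b))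

    contract-adj : ∀ a b → (not (eqb a b) ∧ (G a b ∨ (eqb a u ∧ G v b) ∨ (eqb b u ∧ G a v))) ≡ G a b
    contract-adj a b with a ≟ b
    ... | yes refl = sym (loopless a)
    ... | no a≢b rewrite merged-edge-absent a b a≢b | sym-G a v | merged-edge-absent b a (a≢b ∘ sym) =
      ∨-identityʳ (G a b)

  contract≗deleteVertex : ∀ x y → contract G u v x y ≡ deleteVertex G v x y
  contract≗deleteVertex x y = contract-adj (punchIn v x) (punchIn v y)

  deg-deleteVertex-≢u : ∀ x → punchIn v x ≢ u → deg (deleteVertex G v) x ≡ deg G (punchIn v x)
  deg-deleteVertex-≢u x x≢u = deg-deleteVertex-¬Adj G v x (≢u⇒≁v x≢u)

  extend-strongDom : ∀ {D′} → IsStrongDom (deleteVertex G v) D′ →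
                     IsStrongDom G (⁅ u ⁆ ∪ insertAt D′ v outside)
  extend-strongDom {D′} dom x x∉D with v ≟ x
  ... | yes refl = u , x∈p∪q⁺ (inj₁ (x∈⁅x⁆ u)) , v∼u , subst (_≤ deg G u) (sym deg-v) (Adj⇒0<deg G u∼v)
  ... | no v≢x with punchOut v≢x | punchIn-punchOut v≢x
  ...   | x′ | refl with dom x′ (x∉D ∘ x∈p∪q⁺ ∘ inj₂ ∘ ∈-insertAt⁺ v outside)
  ...     | y′ , y′∈D′ , x′∼y′ , dx′≤dy′ =
    punchIn v y′ , x∈p∪q⁺ (inj₂ (∈-insertAt⁺ v outside y′∈D′)) , x′∼y′ , dx≤dy
    where
    x≢u : punchIn v x′ ≢ u
    x≢u x≡u = x∉D (x∈p∪q⁺ (inj₁ (subst (_∈ ⁅ u ⁆) (sym x≡u) (x∈⁅x⁆ u))))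
    dx≤dy : deg G (punchIn v x′) ≤ deg G (punchIn v y′)
    dx≤dy = begin
      deg G (punchIn v x′)        ≡⟨ deg-deleteVertex-≢u x′ x≢u ⟨
      deg (deleteVertex G v) x′   ≤⟨ dx′≤dy′ ⟩
      deg (deleteVertex G v) y′   ≤⟨ deg-deleteVertex≤ G v y′ ⟩
      deg G (punchIn v y′)        ∎
      where open ≤-Reasoning

  N[u] : Subset (suc n)
  N[u] = ⁅ u ⁆ ∪ nbhd G u

  u∈N[u] : u ∈ N[u]
  u∈N[u] = x∈p∪q⁺ (inj₁ (x∈⁅x⁆ u))

  Adj⇒∈N[u] : ∀ {y} → Adj G u y → y ∈ N[u]
  Adj⇒∈N[u] u∼y = x∈p∪q⁺ (inj₂ (Adj⇒∈nbhd G u∼y))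

  ∉N[u]⇒≢u : ∀ {x} → x ∉ N[u] → x ≢ u
  ∉N[u]⇒≢u x∉N[u] x≡u = x∉N[u] (subst (_∈ N[u]) (sym x≡u) u∈N[u])

  ∉-restrict : ∀ D {x} → x ∉ removeAt (D ∪ N[u]) v → punchIn v x ∉ D × punchIn v x ∉ N[u]
  ∉-restrict D x∉D′ = x∉D′ ∘ ∈-removeAt⁺ (D ∪ N[u]) v ∘ p⊆p∪q N[u] ,
                      x∉D′ ∘ ∈-removeAt⁺ (D ∪ N[u]) v ∘ q⊆p∪q D N[u]

  restrict-strongDom : ∀ {D} → IsStrongDom G D → IsStrongDom (deleteVertex G v) (removeAt (D ∪ N[u]) v)
  restrict-strongDom {D} dom x x∉D′ with ∉-restrict D x∉D′
  ... | x∉D , x∉N[u] with dom (punchIn v x) x∉D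
  ...   | y , y∈D , x∼y , dx≤dy with v ≟ y
  ...     | yes refl = contradiction (v∼y⇒y≡u (trans (sym-G v _) x∼y)) (∉N[u]⇒≢u x∉N[u])
  ...     | no v≢y with punchOut v≢y | punchIn-punchOut v≢y
  ...       | y′ | refl = y′ , ∈-removeAt⁺ (D ∪ N[u]) v (p⊆p∪q N[u] y∈D) , x∼y , dx≤dy′
    where
    y≢u : punchIn v y′ ≢ u
    y≢u y≡u = x∉N[u] (Adj⇒∈N[u] (trans (sym-G u _) (subst (Adj G _) y≡u x∼y)))
    dx≤dy′ : deg (deleteVertex G v) x ≤ deg (deleteVertex G v) y′
    dx≤dy′ = subst₂ _≤_ (sym (deg-deleteVertex-≢u x (∉N[u]⇒≢u x∉N[u])))
                        (sym (deg-deleteVertex-≢u y′ y≢u)) dx≤dy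

  ∣extend∣≤ : ∀ D′ → ∣ ⁅ u ⁆ ∪ insertAt D′ v outside ∣ ≤ suc ∣ D′ ∣
  ∣extend∣≤ D′ = ≤-trans (∣p∪q∣≤∣p∣+∣q∣ ⁅ u ⁆ (insertAt D′ v outside))
                         (≤-reflexive (cong₂ _+_ (∣⁅x⁆∣≡1 u) (∣insertAt∣ D′ v outside)))

  ∣N[u]∣≤ : ∣ N[u] ∣ ≤ suc (deg G u)
  ∣N[u]∣≤ = ≤-trans (∣p∪q∣≤∣p∣+∣q∣ ⁅ u ⁆ (nbhd G u))
                    (≤-reflexive (cong₂ _+_ (∣⁅x⁆∣≡1 u) (sym (deg≡∣nbhd∣ G u))))

  strongDom-meets-N[u] : ∀ {D} → IsStrongDom G D → ∃ λ x → x ∈ D ∩ N[u]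
  strongDom-meets-N[u] {D} dom with v ∈? D
  ... | yes v∈D = v , x∈p∩q⁺ (v∈D , Adj⇒∈N[u] u∼v)
  ... | no v∉D with dom v v∉D
  ...   | y , y∈D , v∼y , _ = u , x∈p∩q⁺ (subst (_∈ D) (v∼y⇒y≡u v∼y) y∈D , u∈N[u])

  ∣restrict∣< : ∀ {D} → IsStrongDom G D → suc ∣ removeAt (D ∪ N[u]) v ∣ ≤ ∣ D ∣ + deg G u
  ∣restrict∣< {D} dom with strongDom-meets-N[u] dom
  ... | _ , x∈D∩N[u] = ≤-pred (begin
    suc (suc ∣ removeAt (D ∪ N[u]) v ∣)  ≡⟨ cong suc ∣D∪N[u]∣≡ ⟨
    suc ∣ D ∪ N[u] ∣                     ≤⟨ x∈p∩q⇒∣p∪q∣<∣p∣+∣q∣ D N[u] x∈D∩N[u] ⟩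
    ∣ D ∣ + ∣ N[u] ∣                     ≤⟨ +-monoʳ-≤ ∣ D ∣ ∣N[u]∣≤ ⟩
    ∣ D ∣ + suc (deg G u)                ≡⟨ +-suc ∣ D ∣ (deg G u) ⟩
    suc (∣ D ∣ + deg G u)                ∎)
    where
    open ≤-Reasoning
    ∣D∪N[u]∣≡ : ∣ D ∪ N[u] ∣ ≡ suc ∣ removeAt (D ∪ N[u]) v ∣
    ∣D∪N[u]∣≡ = trans (∣removeAt∣ (D ∪ N[u]) v)
                      (cong (λ b → ∣ b ∷ removeAt (D ∪ N[u]) v ∣) ([]=⇒lookup (q⊆p∪q D N[u] (Adj⇒∈N[u] u∼v))))

  deleteVertex≗contract : ∀ x y → deleteVertex G v x y ≡ contract G u v x y
  deleteVertex≗contract x y = sym (contract≗deleteVertex x y)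

  γst-lower : ∀ {k k′} → IsGammaSt G k → IsGammaSt (contract G u v) k′ → k ≤ k′ + 1
  γst-lower {k} {k′} (_ , minimal) ((D′ , dom , ∣D′∣≡k′) , _) = begin
    k                                      ≤⟨ minimal _ (extend-strongDom (IsStrongDom-resp-≗ contract≗deleteVertex dom)) ⟩
    ∣ ⁅ u ⁆ ∪ insertAt D′ v outside ∣      ≤⟨ ∣extend∣≤ D′ ⟩
    suc ∣ D′ ∣                             ≡⟨ cong suc ∣D′∣≡k′ ⟩
    suc k′                                 ≡⟨ +-comm 1 k′ ⟩
    k′ + 1                                 ∎
    where open ≤-Reasoning

  γst-upper : ∀ {k k′} → IsGammaSt G k → IsGammaSt (contract G u v) k′ → k′ + 1 ≤ k + deg G u
  γst-upper {k} {k′} ((D , dom , ∣D∣≡k) , _) (_ , minimal) = begin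
    k′ + 1                                 ≡⟨ +-comm k′ 1 ⟩
    suc k′                                 ≤⟨ s≤s (minimal _ restricted-dom) ⟩
    suc ∣ removeAt (D ∪ N[u]) v ∣          ≤⟨ ∣restrict∣< dom ⟩
    ∣ D ∣ + deg G u                        ≡⟨ cong (_+ deg G u) ∣D∣≡k ⟩
    k + deg G u                            ∎
    where
    open ≤-Reasoning
    restricted-dom : IsStrongDom (contract G u v) (removeAt (D ∪ N[u]) v)
    restricted-dom = IsStrongDom-resp-≗ deleteVertex≗contract (restrict-strongDom dom)

corollary1 : ∀ {n} (G : Graph (suc n)) (u v : Fin (suc n)) →
    IsSimple G → Adj G u v → deg G v ≡ 1 →
    ∀ k k′ → IsGammaSt G k → IsGammaSt (contract G u v) k′ →
    (k ≤ k′ + 1) × (k′ + 1 ≤ k + deg G u)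
corollary1 G u v simple u∼v deg-v k k′ γG γH =
  γst-lower γG γH , γst-upper γG γH
  where open PendantEdge G simple u∼v deg-v
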